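{- Let $\zeta=e^{2\pi i/5}$, $F=\mathbb{Q}(\zeta)$ with ring of integers $\mathcal{O}$, and let $\mathcal{O}_k$ be the ring of integers of $k=\mathbb{Q}(\sqrt5)\subset F$. Let $\mathcal{O}_k^+$ denote the set of totally positive elements of $\mathcal{O}_k$. For every $b\in\mathcal{O}_k^+$ there exist $\alpha\in\mathcal{O}\setminus\{0\}$ and $t\in\mathcal{O}_k^+\cup\{0\}$ such that $b=\alpha\bar\alpha+t$, where $\bar{\cdot}$ is complex conjugation. -}

module Defs where

open import Data.Integer using (ℤ; +_; _+_; _-_; _*_; -_; _<_; _≤_)
open import Data.Product using (_×_)
open import Data.Sum using (_⊎_)

-- 𝒪 = ring of integers of F = ℚ(ζ), ζ = e^{2πi/5}.  𝒪 = ℤ[ζ] with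
-- ℤ-basis 1, ζ, ζ², ζ³ (minimal polynomial 1+x+x²+x³+x⁴).
-- ⟨ a0 , a1 , a2 , a3 ⟩ denotes a0 + a1 ζ + a2 ζ² + a3 ζ³.

record 𝒪 : Set where
  constructor ⟨_,_,_,_⟩
  field
    c0 c1 c2 c3 : ℤ

open 𝒪 public

0𝒪 : 𝒪
0𝒪 = ⟨ + 0 , + 0 , + 0 , + 0 ⟩

_+𝒪_ : 𝒪 → 𝒪 → 𝒪
⟨ a0 , a1 , a2 , a3 ⟩ +𝒪 ⟨ b0 , b1 , b2 , b3 ⟩ =
  ⟨ a0 + b0 , a1 + b1 , a2 + b2 , a3 + b3 ⟩

-- Multiplication: compute coefficients of ζ⁰..ζ⁴ using ζ⁵ = 1,
-- then reduce ζ⁴ = -1 - ζ - ζ² - ζ³.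
_*𝒪_ : 𝒪 → 𝒪 → 𝒪
⟨ a0 , a1 , a2 , a3 ⟩ *𝒪 ⟨ b0 , b1 , b2 , b3 ⟩ =
  ⟨ e0 - e4 , e1 - e4 , e2 - e4 , e3 - e4 ⟩
  where
  e0 e1 e2 e3 e4 : ℤ
  e0 = a0 * b0 + a2 * b3 + a3 * b2
  e1 = a0 * b1 + a1 * b0 + a3 * b3
  e2 = a0 * b2 + a1 * b1 + a2 * b0
  e3 = a0 * b3 + a1 * b2 + a2 * b1 + a3 * b0
  e4 = a1 * b3 + a2 * b2 + a3 * b1

-- Complex conjugation: ζ ↦ ζ̄ = ζ⁴, ζ² ↦ ζ³, ζ³ ↦ ζ².
-- a0 + a1 ζ⁴ + a2 ζ³ + a3 ζ² = (a0-a1) - a1 ζ + (a3-a1) ζ² + (a2-a1) ζ³.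
conj : 𝒪 → 𝒪
conj ⟨ a0 , a1 , a2 , a3 ⟩ = ⟨ a0 - a1 , - a1 , a3 - a1 , a2 - a1 ⟩

-- 𝒪ₖ = ring of integers of k = ℚ(√5) = ℤ[φ], φ = (1+√5)/2.
-- ⟨ a ∣ b ⟩ₖ denotes a + b φ.

record 𝒪ₖ : Set where
  constructor ⟨_∣_⟩ₖ
  field
    re ph : ℤ

open 𝒪ₖ public

0ₖ : 𝒪ₖ
0ₖ = ⟨ + 0 ∣ + 0 ⟩ₖ

-- The inclusion k ⊂ F on integers: φ = -ζ² - ζ³ (since ζ²+ζ³ = 2cos(4π/5)).
ι : 𝒪ₖ → 𝒪
ι ⟨ a ∣ b ⟩ₖ = ⟨ a , + 0 , - b , - b ⟩

-- PosR5 x y  :⇔  the real number x + y√5 is > 0 (exact integer test).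
PosR5 : ℤ → ℤ → Set
PosR5 x y =
  (+ 0 ≤ x × + 0 ≤ y × (+ 0 < x ⊎ + 0 < y))
  ⊎ (+ 0 < x × + 5 * (y * y) < x * x)
  ⊎ (+ 0 < y × x * x < + 5 * (y * y))

-- Totally positive: both real embeddings a + b(1 ± √5)/2 are > 0,
-- i.e. (2a + b) ± b√5 > 0.
TotPos : 𝒪ₖ → Set
TotPos ⟨ a ∣ b ⟩ₖ = PosR5 (+ 2 * a + b) b × PosR5 (+ 2 * a + b) (- b)

{-# OPTIONS --safe #-}
module Submission where

-- Write b = a + cφ, so that its two real embeddings are (tr b ± c√5)/2 with
-- tr b = 2a + c.  The units φ² and φ⁻² are totally positive, and both are norms
-- from F: φ² = (1+ζ)(1+ζ)‾ and φ⁻² = ε ε̄ with ε = (1+ζ)⁻¹.  Hence a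
-- representation φ^∓2 b = α ᾱ + t yields b = (εα)(εα)‾ + φ^±2 t for the
-- corresponding ε.  Since 2 tr (φ^∓2 b) = 3 tr b ∓ 5c, multiplying by one of
-- these units strictly lowers the (positive, integral) trace as long as
-- tr b < 5|c|.  Once 5|c| ≤ tr b, b − 1 is totally positive or zero, because
-- 4 N(b − 1) = (tr b − 2 − 3c)(tr b − 2 + 3c) + 4c², and b = 1·1̄ + (b − 1).

open import Defs
open import Algebra.Bundles using (CommutativeSemigroup)
import Algebra.Properties.CommutativeSemigroup as CommutativeSemigroupProperties
open import Data.Empty using (⊥-elim)
open import Data.Fin using (#_)
open import Data.Integer.Base
  using (ℤ; +_; +[1+_]; -[1+_]; _+_; _*_; -_; _-_; _<_; _≤_; +<+; +≤+; ∣_∣)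
open import Data.Integer.Properties
  using ( +-monoʳ-<; +-monoˡ-<; +-mono-≤; +-mono-<-≤; +-mono-≤-<
        ; *-zeroʳ; *-monoˡ-<-pos; *-cancelˡ-<-nonNeg; pos-*
        ; _<?_; <⇒≤; <⇒≱; ≮⇒≥; <-≤-trans; ≤-reflexive
        ; i≤j⇒0≤j-i; i<j⇒suc[i]≤j; i<j⇒i≤pred[j]; 0≤i⇒+∣i∣≡i )
open import Data.Integer.Tactic.RingSolver using (ring; solve-∀)
open import Data.Nat.Base using (ℕ; zero; suc; z≤n; s≤s)
open import Data.Product.Base using (Σ; _×_; _,_; proj₁)
open import Data.Sum.Base using (_⊎_; inj₁; inj₂)
open import Data.Vec.Base using (Vec; []; _∷_)
open import Level using (0ℓ)
open import Relation.Binary.PropositionalEquality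
open import Relation.Binary.PropositionalEquality.Algebra using (isMagma)
open import Relation.Nullary using (yes; no)
open import Tactic.RingSolver.NonReflective ring using (Expr; Κ; Ι; _⊕_; _⊗_; ⊝_; module Ops)
open Ops using (⟦_⟧; ⟦_⇓⟧; prove)
open ≡-Reasoning

⟨,,,⟩-cong : ∀ {a b c d a′ b′ c′ d′} → a ≡ a′ → b ≡ b′ → c ≡ c′ → d ≡ d′ →
             ⟨ a , b , c , d ⟩ ≡ ⟨ a′ , b′ , c′ , d′ ⟩
⟨,,,⟩-cong refl refl refl refl = refl

-- The operations of Defs on formal elements of 𝒪 whose coordinates are ring-solver
-- expressions.  Evaluating a formal element coordinatewise (⟦_⟧𝒪) turns these
-- operations definitionally into those of Defs, so an identity in 𝒪 holds as soon
-- as the normal forms of the coordinates of both sides agree (𝒪-prove).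
record 𝒪ᴱ (n : ℕ) : Set where
  constructor ⟨_,_,_,_⟩ᴱ
  field c0ᴱ c1ᴱ c2ᴱ c3ᴱ : Expr ℤ n

open 𝒪ᴱ

module _ {n : ℕ} where

  infixl 6 _⊖_ _+ᴱ_
  infixl 7 _*ᴱ_

  _⊖_ : Expr ℤ n → Expr ℤ n → Expr ℤ n
  x ⊖ y = x ⊕ ⊝ y

  0ᴱ 1ᴱ : 𝒪ᴱ n
  0ᴱ = ⟨ Κ (+ 0) , Κ (+ 0) , Κ (+ 0) , Κ (+ 0) ⟩ᴱ
  1ᴱ = ⟨ Κ (+ 1) , Κ (+ 0) , Κ (+ 0) , Κ (+ 0) ⟩ᴱ

  _+ᴱ_ : 𝒪ᴱ n → 𝒪ᴱ n → 𝒪ᴱ n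
  ⟨ a0 , a1 , a2 , a3 ⟩ᴱ +ᴱ ⟨ b0 , b1 , b2 , b3 ⟩ᴱ = ⟨ a0 ⊕ b0 , a1 ⊕ b1 , a2 ⊕ b2 , a3 ⊕ b3 ⟩ᴱ

  _*ᴱ_ : 𝒪ᴱ n → 𝒪ᴱ n → 𝒪ᴱ n
  ⟨ a0 , a1 , a2 , a3 ⟩ᴱ *ᴱ ⟨ b0 , b1 , b2 , b3 ⟩ᴱ = ⟨ e0 ⊖ e4 , e1 ⊖ e4 , e2 ⊖ e4 , e3 ⊖ e4 ⟩ᴱ
    where
    e0 e1 e2 e3 e4 : Expr ℤ n
    e0 = a0 ⊗ b0 ⊕ a2 ⊗ b3 ⊕ a3 ⊗ b2
    e1 = a0 ⊗ b1 ⊕ a1 ⊗ b0 ⊕ a3 ⊗ b3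
    e2 = a0 ⊗ b2 ⊕ a1 ⊗ b1 ⊕ a2 ⊗ b0
    e3 = a0 ⊗ b3 ⊕ a1 ⊗ b2 ⊕ a2 ⊗ b1 ⊕ a3 ⊗ b0
    e4 = a1 ⊗ b3 ⊕ a2 ⊗ b2 ⊕ a3 ⊗ b1

  conjᴱ : 𝒪ᴱ n → 𝒪ᴱ n
  conjᴱ ⟨ a0 , a1 , a2 , a3 ⟩ᴱ = ⟨ a0 ⊖ a1 , ⊝ a1 , a3 ⊖ a1 , a2 ⊖ a1 ⟩ᴱ

  ιᴱ : Expr ℤ n → Expr ℤ n → 𝒪ᴱ n
  ιᴱ a b = ⟨ a , Κ (+ 0) , ⊝ b , ⊝ b ⟩ᴱ

  ⟦_⟧𝒪 ⟦_⇓⟧𝒪 : 𝒪ᴱ n → Vec ℤ n → 𝒪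
  ⟦ x ⟧𝒪 ρ = ⟨ ⟦ c0ᴱ x ⟧ ρ , ⟦ c1ᴱ x ⟧ ρ , ⟦ c2ᴱ x ⟧ ρ , ⟦ c3ᴱ x ⟧ ρ ⟩
  ⟦ x ⇓⟧𝒪 ρ = ⟨ ⟦ c0ᴱ x ⇓⟧ ρ , ⟦ c1ᴱ x ⇓⟧ ρ , ⟦ c2ᴱ x ⇓⟧ ρ , ⟦ c3ᴱ x ⇓⟧ ρ ⟩

  𝒪-prove : ∀ ρ (x y : 𝒪ᴱ n) → ⟦ x ⇓⟧𝒪 ρ ≡ ⟦ y ⇓⟧𝒪 ρ → ⟦ x ⟧𝒪 ρ ≡ ⟦ y ⟧𝒪 ρ
  𝒪-prove ρ x y x≡y =
    ⟨,,,⟩-cong (prove ρ (c0ᴱ x) (c0ᴱ y) (cong c0 x≡y)) (prove ρ (c1ᴱ x) (c1ᴱ y) (cong c1 x≡y))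
               (prove ρ (c2ᴱ x) (c2ᴱ y) (cong c2 x≡y)) (prove ρ (c3ᴱ x) (c3ᴱ y) (cong c3 x≡y))

x̂ ŷ ẑ : 𝒪ᴱ 12
x̂ = ⟨ Ι (# 0) , Ι (# 1) , Ι (# 2)  , Ι (# 3)  ⟩ᴱ
ŷ = ⟨ Ι (# 4) , Ι (# 5) , Ι (# 6)  , Ι (# 7)  ⟩ᴱ
ẑ = ⟨ Ι (# 8) , Ι (# 9) , Ι (# 10) , Ι (# 11) ⟩ᴱ

coordinates : 𝒪 → 𝒪 → 𝒪 → Vec ℤ 12
coordinates x y z =
  c0 x ∷ c1 x ∷ c2 x ∷ c3 x ∷ c0 y ∷ c1 y ∷ c2 y ∷ c3 y ∷ c0 z ∷ c1 z ∷ c2 z ∷ c3 z ∷ []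

1𝒪 : 𝒪
1𝒪 = ⟨ + 1 , + 0 , + 0 , + 0 ⟩

*𝒪-comm : ∀ x y → x *𝒪 y ≡ y *𝒪 x
*𝒪-comm x y = 𝒪-prove (coordinates x y 0𝒪) (x̂ *ᴱ ŷ) (ŷ *ᴱ x̂) refl

*𝒪-assoc : ∀ x y z → (x *𝒪 y) *𝒪 z ≡ x *𝒪 (y *𝒪 z)
*𝒪-assoc x y z = 𝒪-prove (coordinates x y z) (x̂ *ᴱ ŷ *ᴱ ẑ) (x̂ *ᴱ (ŷ *ᴱ ẑ)) refl

*𝒪-identityˡ : ∀ x → 1𝒪 *𝒪 x ≡ x
*𝒪-identityˡ x = 𝒪-prove (coordinates x 0𝒪 0𝒪) (1ᴱ *ᴱ x̂) x̂ refl

*𝒪-zeroʳ : ∀ x → x *𝒪 0𝒪 ≡ 0𝒪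
*𝒪-zeroʳ x = 𝒪-prove (coordinates x 0𝒪 0𝒪) (x̂ *ᴱ 0ᴱ) 0ᴱ refl

*𝒪-distribˡ-+𝒪 : ∀ x y z → x *𝒪 (y +𝒪 z) ≡ (x *𝒪 y) +𝒪 (x *𝒪 z)
*𝒪-distribˡ-+𝒪 x y z = 𝒪-prove (coordinates x y z) (x̂ *ᴱ (ŷ +ᴱ ẑ)) (x̂ *ᴱ ŷ +ᴱ x̂ *ᴱ ẑ) refl

conj-*𝒪 : ∀ x y → conj (x *𝒪 y) ≡ conj x *𝒪 conj y
conj-*𝒪 x y = 𝒪-prove (coordinates x y 0𝒪) (conjᴱ (x̂ *ᴱ ŷ)) (conjᴱ x̂ *ᴱ conjᴱ ŷ) refl

*𝒪-commutativeSemigroup : CommutativeSemigroup 0ℓ 0ℓ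
*𝒪-commutativeSemigroup = record
  { isCommutativeSemigroup = record
    { isSemigroup = record { isMagma = isMagma _*𝒪_ ; assoc = *𝒪-assoc }
    ; comm = *𝒪-comm
    }
  }

open CommutativeSemigroupProperties *𝒪-commutativeSemigroup
  using () renaming (interchange to *𝒪-interchange)

*𝒪-unit-≢0 : ∀ ε ε′ {α} → ε′ *𝒪 ε ≡ 1𝒪 → α ≢ 0𝒪 → ε *𝒪 α ≢ 0𝒪
*𝒪-unit-≢0 ε ε′ {α} ε′ε≡1 α≢0 εα≡0 = α≢0 (begin
  α                ≡⟨ *𝒪-identityˡ α ⟨
  1𝒪 *𝒪 α          ≡⟨ cong (_*𝒪 α) ε′ε≡1 ⟨
  (ε′ *𝒪 ε) *𝒪 α   ≡⟨ *𝒪-assoc ε′ ε α ⟩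
  ε′ *𝒪 (ε *𝒪 α)   ≡⟨ cong (ε′ *𝒪_) εα≡0 ⟩
  ε′ *𝒪 0𝒪         ≡⟨ *𝒪-zeroʳ ε′ ⟩
  0𝒪               ∎)

*𝒪-conj-square : ∀ ε u → ε *𝒪 conj ε ≡ ι u → ∀ α →
                 ι u *𝒪 (α *𝒪 conj α) ≡ (ε *𝒪 α) *𝒪 conj (ε *𝒪 α)
*𝒪-conj-square ε u εε̄≡u α = begin
  ι u *𝒪 (α *𝒪 conj α)                ≡⟨ cong (_*𝒪 (α *𝒪 conj α)) εε̄≡u ⟨
  (ε *𝒪 conj ε) *𝒪 (α *𝒪 conj α)      ≡⟨ *𝒪-interchange ε (conj ε) α (conj α) ⟩
  (ε *𝒪 α) *𝒪 (conj ε *𝒪 conj α)      ≡⟨ cong ((ε *𝒪 α) *𝒪_) (conj-*𝒪 ε α) ⟨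
  (ε *𝒪 α) *𝒪 conj (ε *𝒪 α)           ∎

-- Multiplication in ℤ[φ], using φ² = φ + 1.
_*ₖ_ : 𝒪ₖ → 𝒪ₖ → 𝒪ₖ
⟨ a ∣ b ⟩ₖ *ₖ ⟨ c ∣ d ⟩ₖ = ⟨ a * c + b * d ∣ a * d + b * c + b * d ⟩ₖ

1ₖ : 𝒪ₖ
1ₖ = ⟨ + 1 ∣ + 0 ⟩ₖ

*ₖ-zeroʳ : ∀ x → x *ₖ 0ₖ ≡ 0ₖ
*ₖ-zeroʳ ⟨ a ∣ c ⟩ₖ rewrite *-zeroʳ a | *-zeroʳ c = refl

ι-*ₖ : ∀ x y → ι (x *ₖ y) ≡ ι x *𝒪 ι y
ι-*ₖ x y = 𝒪-prove (re x ∷ ph x ∷ re y ∷ ph y ∷ [])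
  (ιᴱ (a ⊗ a′ ⊕ c ⊗ c′) (a ⊗ c′ ⊕ c ⊗ a′ ⊕ c ⊗ c′)) (ιᴱ a c *ᴱ ιᴱ a′ c′) refl
  where
  a c a′ c′ : Expr ℤ 4
  a = Ι (# 0); c = Ι (# 1); a′ = Ι (# 2); c′ = Ι (# 3)

ι-*ₖ-inverse : ∀ u u′ → u *ₖ u′ ≡ 1ₖ → ∀ b → ι b ≡ ι u *𝒪 ι (u′ *ₖ b)
ι-*ₖ-inverse u u′ uu′≡1 b = begin
  ι b                     ≡⟨ *𝒪-identityˡ (ι b) ⟨
  1𝒪 *𝒪 ι b               ≡⟨ cong (λ v → ι v *𝒪 ι b) uu′≡1 ⟨
  ι (u *ₖ u′) *𝒪 ι b      ≡⟨ cong (_*𝒪 ι b) (ι-*ₖ u u′) ⟩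
  (ι u *𝒪 ι u′) *𝒪 ι b    ≡⟨ *𝒪-assoc (ι u) (ι u′) (ι b) ⟩
  ι u *𝒪 (ι u′ *𝒪 ι b)    ≡⟨ cong (ι u *𝒪_) (ι-*ₖ u′ b) ⟨
  ι u *𝒪 ι (u′ *ₖ b)      ∎

φ² : 𝒪ₖ
φ² = ⟨ + 1 ∣ + 1 ⟩ₖ

φ⁻² : 𝒪ₖ
φ⁻² = ⟨ + 2 ∣ - + 1 ⟩ₖ

φ⁻²-inverseʳ : φ² *ₖ φ⁻² ≡ 1ₖ
φ⁻²-inverseʳ = refl

φ⁻²-inverseˡ : φ⁻² *ₖ φ² ≡ 1ₖ
φ⁻²-inverseˡ = refl

1+ζ : 𝒪
1+ζ = ⟨ + 1 , + 1 , + 0 , + 0 ⟩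

[1+ζ]⁻¹ : 𝒪
[1+ζ]⁻¹ = ⟨ + 0 , - + 1 , + 0 , - + 1 ⟩

[1+ζ]⁻¹-inverseˡ : [1+ζ]⁻¹ *𝒪 1+ζ ≡ 1𝒪
[1+ζ]⁻¹-inverseˡ = refl

[1+ζ]⁻¹-inverseʳ : 1+ζ *𝒪 [1+ζ]⁻¹ ≡ 1𝒪
[1+ζ]⁻¹-inverseʳ = refl

1+ζ-norm : 1+ζ *𝒪 conj 1+ζ ≡ ι φ²
1+ζ-norm = refl

[1+ζ]⁻¹-norm : [1+ζ]⁻¹ *𝒪 conj [1+ζ]⁻¹ ≡ ι φ⁻²
[1+ζ]⁻¹-norm = refl

<-of-equal-sums : ∀ {a b c d} → a + d ≡ c + b → b < d → a < c
<-of-equal-sums {a} {b} {c} {d} a+d≡c+b b<d =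
  subst₂ _<_ (+-cancelʳ a d) (+-cancelʳ c d) (+-monoˡ-< (- d) a+d<c+d)
  where
  a+d<c+d : a + d < c + d
  a+d<c+d = subst (_< c + d) (sym a+d≡c+b) (+-monoʳ-< c b<d)
  +-cancelʳ : ∀ x y → x + y - y ≡ x
  +-cancelʳ = solve-∀

0≤-* : ∀ {p q} → + 0 ≤ p → + 0 ≤ q → + 0 ≤ p * q
0≤-* (+≤+ {n = m} _) (+≤+ {n = n} _) = subst (+ 0 ≤_) (pos-* m n) (+≤+ z≤n)

0<-* : ∀ {p q} → + 0 < p → + 0 < q → + 0 < p * q
0<-* (+<+ (s≤s z≤n)) (+<+ (s≤s z≤n)) = +<+ (s≤s z≤n)

0≤-square : ∀ p → + 0 ≤ p * p
0≤-square (+ 0)    = +≤+ z≤n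
0≤-square +[1+ n ] = +≤+ z≤n
0≤-square -[1+ n ] = +≤+ z≤n

0<-cancelˡ-* : ∀ p {q} → + 0 < p → + 0 < p * q → + 0 < q
0<-cancelˡ-* +[1+ m ] {+[1+ n ]} _ _ = +<+ (s≤s z≤n)
0<-cancelˡ-* +[1+ m ] {+ 0}      _ h rewrite *-zeroʳ +[1+ m ] = h
0<-cancelˡ-* +[1+ m ] { -[1+ n ]} _ ()
0<-cancelˡ-* (+ 0) (+<+ ())

neg-square : ∀ y → (- y) * (- y) ≡ y * y
neg-square = solve-∀

PosR5-± : ∀ x y → PosR5 x y → PosR5 x (- y) → + 0 < x × + 5 * (y * y) < x * x
PosR5-± x y        (inj₂ (inj₁ x>0×5y²<x²)) _ = x>0×5y²<x²
PosR5-± x y        _ (inj₂ (inj₁ (x>0 , 5y²<x²))) = x>0 , subst (λ z → + 5 * z < x * x) (neg-square y) 5y²<x²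
PosR5-± x (+ 0)    (inj₁ (_ , _ , inj₁ x>0)) _ = x>0 , 0<-* x>0 x>0
PosR5-± x (+ 0)    (inj₁ (_ , _ , inj₂ (+<+ ()))) _
PosR5-± x (+ 0)    (inj₂ (inj₂ (+<+ () , _))) _
PosR5-± x +[1+ m ] _ (inj₁ (_ , () , _))
PosR5-± x +[1+ m ] _ (inj₂ (inj₂ (() , _)))
PosR5-± x -[1+ m ] (inj₁ (_ , () , _)) _
PosR5-± x -[1+ m ] (inj₂ (inj₂ (() , _))) _

trace : 𝒪ₖ → ℤ
trace b = + 2 * re b + ph b

norm : 𝒪ₖ → ℤ
norm b = re b * re b + re b * ph b - ph b * ph b

TotPos⇒0<trace∧0<norm : ∀ b → TotPos b → + 0 < trace b × + 0 < norm b
TotPos⇒0<trace∧0<norm b@(⟨ a ∣ c ⟩ₖ) (b₁>0 , b₂>0) with PosR5-± (trace b) c b₁>0 b₂>0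
... | tr>0 , 5c²<tr² = tr>0 , 0<-cancelˡ-* (+ 4) (+<+ (s≤s z≤n)) (<-of-equal-sums (identity a c) 5c²<tr²)
  where
  identity : ∀ a c → + 0 + (+ 2 * a + c) * (+ 2 * a + c) ≡ + 4 * (a * a + a * c - c * c) + + 5 * (c * c)
  identity = solve-∀

0<trace∧0<norm⇒TotPos : ∀ b → + 0 < trace b → + 0 < norm b → TotPos b
0<trace∧0<norm⇒TotPos b@(⟨ a ∣ c ⟩ₖ) tr>0 N>0 =
  inj₂ (inj₁ (tr>0 , 5c²<tr²)) ,
  inj₂ (inj₁ (tr>0 , subst (λ z → + 5 * z < trace b * trace b) (sym (neg-square c)) 5c²<tr²))
  where
  identity : ∀ a c → + 5 * (c * c) + + 4 * (a * a + a * c - c * c) ≡ (+ 2 * a + c) * (+ 2 * a + c) + + 0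
  identity = solve-∀
  5c²<tr² : + 5 * (c * c) < trace b * trace b
  5c²<tr² = <-of-equal-sums (identity a c) (*-monoˡ-<-pos (+ 4) N>0)

norm-*ₖ : ∀ x y → norm (x *ₖ y) ≡ norm x * norm y
norm-*ₖ ⟨ a ∣ c ⟩ₖ ⟨ a′ ∣ c′ ⟩ₖ = identity a c a′ c′
  where
  identity : ∀ a c a′ c′ → let p = a * a′ + c * c′ ; q = a * c′ + c * a′ + c * c′ in
             p * p + p * q - q * q ≡ (a * a + a * c - c * c) * (a′ * a′ + a′ * c′ - c′ * c′)
  identity = solve-∀

trace-*ₖ : ∀ x y → trace x * trace y * trace (x *ₖ y)
                 ≡ trace x * trace x * norm y + trace y * trace y * norm x
                   + + 5 * (ph (x *ₖ y) * ph (x *ₖ y))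
trace-*ₖ ⟨ a ∣ c ⟩ₖ ⟨ a′ ∣ c′ ⟩ₖ = identity a c a′ c′
  where
  identity : ∀ a c a′ c′ →
    let T = + 2 * a + c ; T′ = + 2 * a′ + c′ ; p = a * a′ + c * c′ ; q = a * c′ + c * a′ + c * c′ in
    T * T′ * (+ 2 * p + q)
      ≡ T * T * (a′ * a′ + a′ * c′ - c′ * c′) + T′ * T′ * (a * a + a * c - c * c) + + 5 * (q * q)
  identity = solve-∀

TotPos-*ₖ : ∀ x y → TotPos x → TotPos y → TotPos (x *ₖ y)
TotPos-*ₖ x y x≫0 y≫0 with TotPos⇒0<trace∧0<norm x x≫0 | TotPos⇒0<trace∧0<norm y y≫0
... | T>0 , N>0 | T′>0 , N′>0 =
  0<trace∧0<norm⇒TotPos (x *ₖ y) trace>0 (subst (+ 0 <_) (sym (norm-*ₖ x y)) (0<-* N>0 N′>0))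
  where
  trace>0 : + 0 < trace (x *ₖ y)
  trace>0 = 0<-cancelˡ-* (trace x * trace y) (0<-* T>0 T′>0) (subst (+ 0 <_) (sym (trace-*ₖ x y))
    (+-mono-<-≤ (+-mono-<-≤ (0<-* (0<-* T>0 T>0) N′>0) (0≤-* (0≤-square (trace y)) (<⇒≤ N>0)))
                (0≤-* {+ 5} (+≤+ z≤n) (0≤-square (ph (x *ₖ y))))))

TotPos-φ² : TotPos φ²
TotPos-φ² = 0<trace∧0<norm⇒TotPos φ² (+<+ (s≤s z≤n)) (+<+ (s≤s z≤n))

TotPos-φ⁻² : TotPos φ⁻²
TotPos-φ⁻² = 0<trace∧0<norm⇒TotPos φ⁻² (+<+ (s≤s z≤n)) (+<+ (s≤s z≤n))

TotPos-ℕ⁺ : ∀ n → TotPos ⟨ +[1+ n ] ∣ + 0 ⟩ₖ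
TotPos-ℕ⁺ n = positive , positive
  where
  positive : PosR5 (trace ⟨ +[1+ n ] ∣ + 0 ⟩ₖ) (+ 0)
  positive = inj₁ (+≤+ z≤n , +≤+ z≤n , inj₁ (+<+ (s≤s z≤n)))

trace-φ⁻²*ₖ-< : ∀ b → trace b < + 5 * ph b → trace (φ⁻² *ₖ b) < trace b
trace-φ⁻²*ₖ-< ⟨ a ∣ c ⟩ₖ h = *-cancelˡ-<-nonNeg (+ 2) (<-of-equal-sums (identity a c) h)
  where
  identity : ∀ a c → let a′ = + 2 * a + - + 1 * c ; c′ = + 2 * c + - + 1 * a + - + 1 * c in
             + 2 * (+ 2 * a′ + c′) + + 5 * c ≡ + 2 * (+ 2 * a + c) + (+ 2 * a + c)
  identity = solve-∀

trace-φ²*ₖ-< : ∀ b → trace b < - (+ 5 * ph b) → trace (φ² *ₖ b) < trace b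
trace-φ²*ₖ-< ⟨ a ∣ c ⟩ₖ h = *-cancelˡ-<-nonNeg (+ 2) (<-of-equal-sums (identity a c) h)
  where
  identity : ∀ a c → let a′ = + 1 * a + + 1 * c ; c′ = + 1 * c + + 1 * a + + 1 * c in
             + 2 * (+ 2 * a′ + c′) + - (+ 5 * c) ≡ + 2 * (+ 2 * a + c) + (+ 2 * a + c)
  identity = solve-∀

pred-factors-nonNeg : ∀ {U W} → + 0 < W → + 5 * W ≤ U →
  + 0 ≤ U - + 2 - + 3 * W × + 0 ≤ U - + 2 + + 3 * W × + 0 < U - + 2
pred-factors-nonNeg {U} {W} W>0 5W≤U = x≥0 , y≥0 , U-2>0
  where
  x≥0 : + 0 ≤ U - + 2 - + 3 * W
  x≥0 = subst (+ 0 ≤_) (identity U W)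
    (+-mono-≤ (i≤j⇒0≤j-i 5W≤U) (0≤-* {+ 2} (+≤+ z≤n) (i≤j⇒0≤j-i (i<j⇒suc[i]≤j W>0))))
    where
    identity : ∀ U W → U - + 5 * W + + 2 * (W - + 1) ≡ U - + 2 - + 3 * W
    identity = solve-∀
  y≥0 : + 0 ≤ U - + 2 + + 3 * W
  y≥0 = subst (+ 0 ≤_) (identity U W) (+-mono-≤ x≥0 (0≤-* {+ 6} (+≤+ z≤n) (<⇒≤ W>0)))
    where
    identity : ∀ U W → U - + 2 - + 3 * W + + 6 * W ≡ U - + 2 + + 3 * W
    identity = solve-∀
  U-2>0 : + 0 < U - + 2
  U-2>0 = subst (+ 0 <_) (identity U W) (+-mono-≤-< x≥0 (0<-* {+ 3} (+<+ (s≤s z≤n)) W>0))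
    where
    identity : ∀ U W → U - + 2 - + 3 * W + + 3 * W ≡ U - + 2
    identity = solve-∀

pred-TotPos : ∀ a c → let U = trace ⟨ a ∣ c ⟩ₖ in
  + 0 ≤ U - + 2 - + 3 * c → + 0 ≤ U - + 2 + + 3 * c → + 0 < c * c → + 0 < U - + 2 →
  TotPos ⟨ a - + 1 ∣ c ⟩ₖ
pred-TotPos a c x≥0 y≥0 c²>0 U-2>0 =
  0<trace∧0<norm⇒TotPos ⟨ a - + 1 ∣ c ⟩ₖ (subst (+ 0 <_) (trace-identity a c) U-2>0)
    (0<-cancelˡ-* (+ 4) (+<+ (s≤s z≤n)) (subst (+ 0 <_) (norm-identity a c)
      (+-mono-≤-< (0≤-* x≥0 y≥0) (0<-* {+ 4} (+<+ (s≤s z≤n)) c²>0))))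
  where
  trace-identity : ∀ a c → (+ 2 * a + c) - + 2 ≡ + 2 * (a - + 1) + c
  trace-identity = solve-∀
  norm-identity : ∀ a c → let U = + 2 * a + c ; a′ = a - + 1 in
    (U - + 2 - + 3 * c) * (U - + 2 + + 3 * c) + + 4 * (c * c) ≡ + 4 * (a′ * a′ + a′ * c - c * c)
  norm-identity = solve-∀

pred-TotPos⊎0 : ∀ a c → TotPos ⟨ a ∣ c ⟩ₖ →
  + 5 * c ≤ trace ⟨ a ∣ c ⟩ₖ → - (+ 5 * c) ≤ trace ⟨ a ∣ c ⟩ₖ →
  TotPos ⟨ a - + 1 ∣ c ⟩ₖ ⊎ ⟨ a - + 1 ∣ c ⟩ₖ ≡ 0ₖ
pred-TotPos⊎0 a +[1+ m ] _ 5c≤U _ with pred-factors-nonNeg (+<+ (s≤s z≤n)) 5c≤U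
... | x≥0 , y≥0 , U-2>0 = inj₁ (pred-TotPos a +[1+ m ] x≥0 y≥0 (+<+ (s≤s z≤n)) U-2>0)
-- For c = -W the two factors trade places.
pred-TotPos⊎0 a -[1+ m ] _ _ -5c≤U with pred-factors-nonNeg {W = +[1+ m ]} (+<+ (s≤s z≤n)) -5c≤U
... | x≥0 , y≥0 , U-2>0 = inj₁ (pred-TotPos a -[1+ m ] y≥0 x≥0 (+<+ (s≤s z≤n)) U-2>0)
pred-TotPos⊎0 +[1+ 0 ]     (+ 0) _ _ _ = inj₂ refl
pred-TotPos⊎0 +[1+ suc n ] (+ 0) _ _ _ = inj₁ (TotPos-ℕ⁺ n)
pred-TotPos⊎0 (+ 0)        (+ 0) b≫0 _ _ with TotPos⇒0<trace∧0<norm ⟨ + 0 ∣ + 0 ⟩ₖ b≫0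
... | +<+ () , _
pred-TotPos⊎0 -[1+ n ]     (+ 0) b≫0 _ _ with TotPos⇒0<trace∧0<norm ⟨ -[1+ n ] ∣ + 0 ⟩ₖ b≫0
... | () , _

Decomposition : 𝒪ₖ → Set
Decomposition b = Σ 𝒪 λ α → Σ 𝒪ₖ λ t →
  α ≢ 0𝒪 × (TotPos t ⊎ t ≡ 0ₖ) × ι b ≡ (α *𝒪 conj α) +𝒪 ι t

decomposition-*ₖ-unit : ∀ u u′ ε ε′ → TotPos u → u *ₖ u′ ≡ 1ₖ →
  ε′ *𝒪 ε ≡ 1𝒪 → ε *𝒪 conj ε ≡ ι u →
  ∀ b → Decomposition (u′ *ₖ b) → Decomposition b
decomposition-*ₖ-unit u u′ ε ε′ u≫0 uu′≡1 ε′ε≡1 εε̄≡u b (α , t , α≢0 , t≫0 , b′≡αᾱ+t) =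
  ε *𝒪 α , u *ₖ t , *𝒪-unit-≢0 ε ε′ ε′ε≡1 α≢0 , scaled t≫0 , (begin
    ι b                                            ≡⟨ ι-*ₖ-inverse u u′ uu′≡1 b ⟩
    ι u *𝒪 ι (u′ *ₖ b)                             ≡⟨ cong (ι u *𝒪_) b′≡αᾱ+t ⟩
    ι u *𝒪 ((α *𝒪 conj α) +𝒪 ι t)                  ≡⟨ *𝒪-distribˡ-+𝒪 (ι u) (α *𝒪 conj α) (ι t) ⟩
    (ι u *𝒪 (α *𝒪 conj α)) +𝒪 (ι u *𝒪 ι t)         ≡⟨ cong₂ _+𝒪_ (*𝒪-conj-square ε u εε̄≡u α) (sym (ι-*ₖ u t)) ⟩
    ((ε *𝒪 α) *𝒪 conj (ε *𝒪 α)) +𝒪 ι (u *ₖ t)      ∎)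
  where
  scaled : TotPos t ⊎ t ≡ 0ₖ → TotPos (u *ₖ t) ⊎ u *ₖ t ≡ 0ₖ
  scaled (inj₁ t≫0) = inj₁ (TotPos-*ₖ u t u≫0 t≫0)
  scaled (inj₂ refl) = inj₂ (*ₖ-zeroʳ u)

decomposition-φ⁻²*ₖ : ∀ b → Decomposition (φ⁻² *ₖ b) → Decomposition b
decomposition-φ⁻²*ₖ =
  decomposition-*ₖ-unit φ² φ⁻² 1+ζ [1+ζ]⁻¹ TotPos-φ² φ⁻²-inverseʳ [1+ζ]⁻¹-inverseˡ 1+ζ-norm

decomposition-φ²*ₖ : ∀ b → Decomposition (φ² *ₖ b) → Decomposition b
decomposition-φ²*ₖ =
  decomposition-*ₖ-unit φ⁻² φ² [1+ζ]⁻¹ 1+ζ TotPos-φ⁻² φ⁻²-inverseˡ [1+ζ]⁻¹-inverseʳ [1+ζ]⁻¹-norm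

decomposition-via-1 : ∀ b → TotPos b →
  + 5 * ph b ≤ trace b → - (+ 5 * ph b) ≤ trace b → Decomposition b
decomposition-via-1 b@(⟨ a ∣ c ⟩ₖ) b≫0 5c≤U -5c≤U =
  1𝒪 , ⟨ a - + 1 ∣ c ⟩ₖ , (λ ()) , pred-TotPos⊎0 a c b≫0 5c≤U -5c≤U ,
  𝒪-prove (a ∷ c ∷ []) (ιᴱ â ĉ) (1ᴱ *ᴱ conjᴱ 1ᴱ +ᴱ ιᴱ (â ⊖ Κ (+ 1)) ĉ) refl
  where
  â ĉ : Expr ℤ 2
  â = Ι (# 0); ĉ = Ι (# 1)

decompose : ∀ n b → TotPos b → trace b ≤ + n → Decomposition b
decompose zero b b≫0 U≤0 = ⊥-elim (<⇒≱ (proj₁ (TotPos⇒0<trace∧0<norm b b≫0)) U≤0)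
decompose (suc n) b b≫0 U≤1+n with trace b <? + 5 * ph b | trace b <? - (+ 5 * ph b)
... | yes U<5c | _ =
  decomposition-φ⁻²*ₖ b (decompose n (φ⁻² *ₖ b) (TotPos-*ₖ φ⁻² b TotPos-φ⁻² b≫0)
    (i<j⇒i≤pred[j] (<-≤-trans (trace-φ⁻²*ₖ-< b U<5c) U≤1+n)))
... | no _ | yes U<-5c =
  decomposition-φ²*ₖ b (decompose n (φ² *ₖ b) (TotPos-*ₖ φ² b TotPos-φ² b≫0)
    (i<j⇒i≤pred[j] (<-≤-trans (trace-φ²*ₖ-< b U<-5c) U≤1+n)))
... | no U≮5c | no U≮-5c = decomposition-via-1 b b≫0 (≮⇒≥ U≮5c) (≮⇒≥ U≮-5c)

proposition5p8 : (b : 𝒪ₖ) → TotPos b →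
    Σ 𝒪 λ α → Σ 𝒪ₖ λ t →
      α ≢ 0𝒪 × (TotPos t ⊎ t ≡ 0ₖ) × ι b ≡ (α *𝒪 conj α) +𝒪 ι t
proposition5p8 b b≫0 = decompose ∣ trace b ∣ b b≫0
  (≤-reflexive (sym (0≤i⇒+∣i∣≡i (<⇒≤ (proj₁ (TotPos⇒0<trace∧0<norm b b≫0))))))
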